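{- Let $\mathcal{H}=(V,\mathcal{A})$ be a multi-head HyTN in which every node is the tail of some hyperarc, and let $G_{\mathcal{H}}$ be its associated mean payoff game. If $\mathcal{H}$ is consistent, then every node of $G_{\mathcal{H}}$ is a winning start position for Player 1.
   Context: A multi-head HyTN is $(V,\mathcal{A})$ with hyperarcs $A=(t_A,H_A,w_A)$: tail $t_A\in V$, nonempty head set $H_A\subseteq V\setminus\{t_A\}$, weights $w_A(v)\in\mathbb{R}$ for $v\in H_A$; it is consistent if some $s:V\to\mathbb{R}$ satisfies $s(t_A)\ge\min_{v\in H_A}\{s(v)-w_A(v)\}$ for every $A$. A mean payoff game (MPG) is a weighted directed graph $G=(V_0\,\dot\cup\, V_1,E)$ (nodes of $V_p$ controlled by Player $p$, every node having an outgoing arc). A play starts with a pebble on a node $v_0$; at each step the owner of the current node moves the pebble along an outgoing arc; the play ends as soon as a node is revisited, and Player 0 pays Player 1 the average weight of the cycle thus traversed; Player 0 wins if this amount is negative, otherwise Player 1 wins. A node is a winning start position for Player $p$ if Player $p$ has a strategy winning every play starting there. The associated game $G_{\mathcal{H}}$ has $V_0=V$, $V_1=\mathcal{A}$ and arc set $\{(t_A,A,0):A\in\mathcal{A}\}\cup\{(A,h,w_A(h)):A\in\mathcal{A},h\in H_A\}$ (arc $(x,y,w)$ from $x$ to $y$ of weight $w$). -}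

module Defs where

open import Level using (0ℓ)
open import Data.Nat using (ℕ; zero; suc)
open import Data.Fin using (Fin)
open import Data.Fin.Subset using (Subset; _∈_; _∉_; Nonempty)
open import Data.Sum using (_⊎_; inj₁; inj₂)
open import Data.Product using (Σ; ∃; _×_; _,_; proj₁; proj₂)
open import Data.List using (List; []; _∷_; _++_; map; length; foldr; dropWhile)
open import Data.List.Relation.Unary.Unique.Propositional using (Unique)
open import Data.List.Membership.Propositional using () renaming (_∈_ to _∈ˡ_)
open import Data.Empty using (⊥)
open import Relation.Nullary using (¬_; ¬?)
open import Relation.Nullary.Decidable using (does)
open import Data.Bool using (not)
open import Relation.Binary.PropositionalEquality using (_≡_; _≢_)
open import Relation.Binary.Definitions using (DecidableEquality)
open import Relation.Binary.Structures using (IsTotalOrder)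
open import Algebra.Structures using (IsCommutativeRing)
import Data.Fin.Properties as FinP
import Data.Sum.Properties as SumP

-- Ordered fields (the real numbers are one instance).  Equality is
-- propositional; the inverse is a total function that is only
-- constrained on nonzero elements (as for ℝ with 0⁻¹ := 0).

record OrderedField : Set₁ where
  infixl 6 _+_
  infixl 7 _*_
  infix  8 -_
  infix  4 _≤_ _<_
  field
    Carrier : Set
    _+_ _*_ : Carrier → Carrier → Carrier
    -_      : Carrier → Carrier
    0# 1#   : Carrier
    _⁻¹     : Carrier → Carrier
    _≤_     : Carrier → Carrier → Set
    isCommutativeRing : IsCommutativeRing _≡_ _+_ _*_ -_ 0# 1#
    0≢1     : 0# ≢ 1#
    ⁻¹-inverse : ∀ x → x ≢ 0# → x * (x ⁻¹) ≡ 1#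
    isTotalOrder : IsTotalOrder _≡_ _≤_
    +-mono-≤ : ∀ {x y} z → x ≤ y → x + z ≤ y + z
    *-nonneg : ∀ {x y} → 0# ≤ x → 0# ≤ y → 0# ≤ x * y

  _<_ : Carrier → Carrier → Set
  x < y = x ≤ y × x ≢ y

  _-_ : Carrier → Carrier → Carrier
  x - y = x + (- y)

  fromℕ : ℕ → Carrier
  fromℕ zero    = 0#
  fromℕ (suc n) = 1# + fromℕ n

  sumᶠ : List Carrier → Carrier
  sumᶠ = foldr _+_ 0#

module _ (F : OrderedField) where
  open OrderedField F

  record HyTN (n m : ℕ) : Set where
    field
      tail     : Fin m → Fin n
      head     : Fin m → Subset n
      weight   : Fin m → Fin n → Carrier   -- w_A(v), only relevant for v ∈ head A
      head-nonempty : ∀ A → Nonempty (head A)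
      tail∉head     : ∀ A → tail A ∉ head A

  -- s(t_A) ≥ min_{v ∈ H_A} (s(v) - w_A(v)); since H_A is finite and
  -- nonempty this says some v ∈ H_A attains s(v) - w_A(v) ≤ s(t_A).
  Consistent : ∀ {n m} → HyTN n m → Set
  Consistent {n} {m} H =
    Σ (Fin n → Carrier) λ s → ∀ (A : Fin m) →
      Σ (Fin n) λ v → v ∈ head A × (s v - weight A v ≤ s (tail A))
    where open HyTN H

  data Player : Set where
    P0 P1 : Player

  record MPG : Set₁ where
    field
      Node  : Set
      _≟_   : DecidableEquality Node
      owner : Node → Player
      -- Arc u v w : an arc from u to v of weight w (multi-arcs allowed)
      Arc   : Node → Node → Carrier → Set
      hasOut : ∀ u → Σ Node λ v → Σ Carrier λ w → Arc u v w

    Move : Node → Set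
    Move u = Σ Node λ v → Σ Carrier λ w → Arc u v w

    data Hist (v₀ : Node) : Node → Set where
      start : Hist v₀ v₀
      _▷_   : ∀ {u} → Hist v₀ u → (mv : Move u) → Hist v₀ (proj₁ mv)

    steps : ∀ {v₀ u} → Hist v₀ u → List (Node × Carrier)
    steps start = []
    steps (_▷_ {u} h (v , w , _)) = steps h ++ ((u , w) ∷ [])

    -- v₀, …, v_{k-1}: all visited nodes except the current one
    visited : ∀ {v₀ u} → Hist v₀ u → List Node
    visited h = map proj₁ (steps h)

    -- the play has ended: the current node is revisited for the first time
    Ended : ∀ {v₀ u} → Hist v₀ u → Set
    Ended {u = u} h = Unique (visited h) × u ∈ˡ visited h

    -- weights of the cycle closed by the last move
    cycleWeights : ∀ {v₀ u} → Hist v₀ u → List Carrier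
    cycleWeights {u = u} h =
      map proj₂ (dropWhile (λ p → ¬? (proj₁ p ≟ u)) (steps h))

    -- average weight of the traversed cycle (amount Player 0 pays Player 1)
    payoff : ∀ {v₀ u} → Hist v₀ u → Carrier
    payoff h = sumᶠ (cycleWeights h) * (fromℕ (length (cycleWeights h)) ⁻¹)

    Wins : Player → ∀ {v₀ u} → Hist v₀ u → Set
    Wins P0 h = payoff h < 0#
    Wins P1 h = ¬ (payoff h < 0#)

    Strategy : Player → Set
    Strategy p = ∀ {v₀ u} → Hist v₀ u → owner u ≡ p → Move u

    data Follows {p : Player} (σ : Strategy p) {v₀ : Node} : ∀ {u} → Hist v₀ u → Set where
      start : Follows σ start
      step  : ∀ {u} {h : Hist v₀ u} → Follows σ h → (mv : Move u) →
              ((o : owner u ≡ p) → mv ≡ σ h o) → Follows σ (h ▷ mv)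

    WinningStart : Player → Node → Set
    WinningStart p v₀ =
      Σ (Strategy p) λ σ → ∀ {u} (h : Hist v₀ u) → Follows σ h → Ended h → Wins p h

  -- The associated game G_H: V₀ = V (inj₁), V₁ = 𝒜 (inj₂)

  module _ {n m : ℕ} (H : HyTN n m) where
    open HyTN H

    GArc : Fin n ⊎ Fin m → Fin n ⊎ Fin m → Carrier → Set
    GArc (inj₁ v) (inj₂ A) w = (tail A ≡ v) × (w ≡ 0#)
    GArc (inj₂ A) (inj₁ h) w = (h ∈ head A) × (w ≡ weight A h)
    GArc (inj₁ _) (inj₁ _) _ = ⊥
    GArc (inj₂ _) (inj₂ _) _ = ⊥

    GOwner : Fin n ⊎ Fin m → Player
    GOwner (inj₁ _) = P0
    GOwner (inj₂ _) = P1

    EveryNodeIsTail : Set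
    EveryNodeIsTail = ∀ v → Σ (Fin m) λ A → tail A ≡ v

    gOut : EveryNodeIsTail → ∀ u → Σ (Fin n ⊎ Fin m) λ v → Σ Carrier λ w → GArc u v w
    gOut cov (inj₁ v) with cov v
    ... | A , eq = inj₂ A , 0# , eq , Relation.Binary.PropositionalEquality.refl
    gOut cov (inj₂ A) with head-nonempty A
    ... | h , h∈ = inj₁ h , weight A h , h∈ , Relation.Binary.PropositionalEquality.refl

    associatedGame : EveryNodeIsTail → MPG
    associatedGame cov = record
      { Node = Fin n ⊎ Fin m
      ; _≟_ = SumP.≡-dec FinP._≟_ FinP._≟_
      ; owner = GOwner
      ; Arc = GArc
      ; hasOut = gOut cov
      }

-- Player 1 answers a move to hyperarc A with a head v chosen by the consistent
-- schedule s, i.e. one with s(v) - w_A(v) ≤ s(t_A).  Extending s to hyperarc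
-- nodes by s(A) := s(t_A) makes s a potential: along every arc (u, v, w) of a
-- play where Player 1 follows this strategy, s(v) ≤ s(u) + w.  Summing around the
-- closing cycle telescopes to 0 ≤ total weight, so the mean payoff is never
-- negative.
module Submission where

open import Defs
open import Level using (0ℓ)
open import Data.Nat using (ℕ; zero; suc)
open import Data.Fin using (Fin)
open import Data.Sum using (_⊎_; inj₁; inj₂)
open import Data.Product using (_×_; _,_; proj₁; proj₂)
open import Data.List using (List; []; _∷_; _++_; map; length; dropWhile)
open import Data.List.Properties using (map-++)
open import Data.Empty using (⊥-elim)
open import Relation.Nullary using (¬_; ¬?; yes; no)
open import Relation.Unary using (Pred; Decidable)
open import Relation.Binary.PropositionalEquality
open import Relation.Binary.Structures using (IsTotalOrder)
open import Algebra.Bundles using (CommutativeRing)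
import Algebra.Properties.AbelianGroup as AbelianGroupProperties
import Algebra.Properties.Ring as RingProperties

module OrderedFieldProperties (F : OrderedField) where
  open OrderedField F
  open IsTotalOrder isTotalOrder using (total; antisym) renaming (refl to ≤-refl; trans to ≤-trans)

  commutativeRing : CommutativeRing 0ℓ 0ℓ
  commutativeRing = record { isCommutativeRing = isCommutativeRing }

  open CommutativeRing commutativeRing using (+-comm; +-identityˡ; +-assoc; zeroˡ; ring; +-abelianGroup)
  open AbelianGroupProperties +-abelianGroup using (//-rightDividesˡ; //-rightDividesʳ; \\-leftDividesʳ; ε⁻¹≈ε; ⁻¹-involutive)
  open RingProperties ring using (-‿distribˡ-*; -‿distribʳ-*)

  +-cancelʳ-≤ : ∀ {x y} z → x + z ≤ y + z → x ≤ y
  +-cancelʳ-≤ {x} {y} z p = subst₂ _≤_ (//-rightDividesʳ z x) (//-rightDividesʳ z y) (+-mono-≤ (- z) p)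

  -≤⇒≤+ : ∀ {x y} z → x - z ≤ y → x ≤ y + z
  -≤⇒≤+ {x} z p = subst (_≤ _) (//-rightDividesˡ z x) (+-mono-≤ z p)

  x≤x+y : ∀ x {y} → 0# ≤ y → x ≤ x + y
  x≤x+y x {y} p = subst₂ _≤_ (+-identityˡ x) (+-comm y x) (+-mono-≤ x p)

  x≤x+y⇒0≤y : ∀ x {y} → x ≤ x + y → 0# ≤ y
  x≤x+y⇒0≤y x {y} p = +-cancelʳ-≤ x (subst₂ _≤_ (sym (+-identityˡ x)) (+-comm x y) p)

  -‿antimono-≤ : ∀ {x y} → x ≤ y → - y ≤ - x
  -‿antimono-≤ {x} {y} p = +-cancelʳ-≤ (x + y)
    (subst₂ _≤_ (sym (trans (cong (- y +_) (+-comm x y)) (\\-leftDividesʳ y x))) (sym (\\-leftDividesʳ x y)) p)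

  x≤0⇒0≤-x : ∀ {x} → x ≤ 0# → 0# ≤ - x
  x≤0⇒0≤-x p = subst (_≤ _) ε⁻¹≈ε (-‿antimono-≤ p)

  0≤-x⇒x≤0 : ∀ {x} → 0# ≤ - x → x ≤ 0#
  0≤-x⇒x≤0 {x} p = subst₂ _≤_ (⁻¹-involutive x) ε⁻¹≈ε (-‿antimono-≤ p)

  0≤x*x : ∀ x → 0# ≤ x * x
  0≤x*x x with total 0# x
  ... | inj₁ 0≤x = *-nonneg 0≤x 0≤x
  ... | inj₂ x≤0 = subst (0# ≤_) -x*-x≡x*x (*-nonneg (x≤0⇒0≤-x x≤0) (x≤0⇒0≤-x x≤0))
    where
      -x*-x≡x*x : - x * - x ≡ x * x
      -x*-x≡x*x = begin
        - x * - x     ≡⟨ -‿distribˡ-* x (- x) ⟨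
        - (x * - x)   ≡⟨ cong -_ (-‿distribʳ-* x x) ⟨
        - - (x * x)   ≡⟨ ⁻¹-involutive (x * x) ⟩
        x * x         ∎
        where open ≡-Reasoning

  0≤1 : 0# ≤ 1#
  0≤1 = subst (0# ≤_) (CommutativeRing.*-identityˡ commutativeRing 1#) (0≤x*x 1#)

  1≰0 : ¬ 1# ≤ 0#
  1≰0 p = 0≢1 (antisym 0≤1 p)

  ⁻¹-nonneg : ∀ {x} → 0# ≤ x → x ≢ 0# → 0# ≤ x ⁻¹
  ⁻¹-nonneg {x} 0≤x x≢0 with total 0# (x ⁻¹)
  ... | inj₁ 0≤x⁻¹ = 0≤x⁻¹
  ... | inj₂ x⁻¹≤0 = ⊥-elim (1≰0 (0≤-x⇒x≤0 0≤-1))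
    where
      0≤-1 : 0# ≤ - 1#
      0≤-1 = subst (0# ≤_) (trans (sym (-‿distribʳ-* x (x ⁻¹))) (cong -_ (⁻¹-inverse x x≢0)))
                   (*-nonneg 0≤x (x≤0⇒0≤-x x⁻¹≤0))

  fromℕ-nonneg : ∀ k → 0# ≤ fromℕ k
  fromℕ-nonneg zero    = ≤-refl
  fromℕ-nonneg (suc k) = ≤-trans 0≤1 (x≤x+y 1# (fromℕ-nonneg k))

  fromℕ-suc≢0 : ∀ k → fromℕ (suc k) ≢ 0#
  fromℕ-suc≢0 k eq = 1≰0 (subst (1# ≤_) eq (x≤x+y 1# (fromℕ-nonneg k)))

  -- For the empty list the mean is 0 * 0⁻¹ = 0, so no length hypothesis is needed.
  mean-nonneg : ∀ xs → 0# ≤ sumᶠ xs → 0# ≤ sumᶠ xs * fromℕ (length xs) ⁻¹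
  mean-nonneg []       _  = subst (0# ≤_) (sym (zeroˡ _)) ≤-refl
  mean-nonneg (x ∷ xs) 0≤Σ = *-nonneg 0≤Σ (⁻¹-nonneg (fromℕ-nonneg (suc (length xs))) (fromℕ-suc≢0 (length xs)))

  sumᶠ-++ : ∀ xs ys → sumᶠ (xs ++ ys) ≡ sumᶠ xs + sumᶠ ys
  sumᶠ-++ []       ys = sym (+-identityˡ (sumᶠ ys))
  sumᶠ-++ (x ∷ xs) ys = trans (cong (x +_) (sumᶠ-++ xs ys)) (sym (+-assoc x (sumᶠ xs) (sumᶠ ys)))

module _ {A : Set} {P : Pred A 0ℓ} (P? : Decidable P) where

  dropWhile-++-[] : ∀ xs ys → dropWhile P? xs ≡ [] → dropWhile P? (xs ++ ys) ≡ dropWhile P? ys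
  dropWhile-++-[] []       ys eq = refl
  dropWhile-++-[] (x ∷ xs) ys eq with P? x
  ... | yes _ = dropWhile-++-[] xs ys eq

  dropWhile-++-∷ : ∀ xs ys {z zs} → dropWhile P? xs ≡ z ∷ zs → dropWhile P? (xs ++ ys) ≡ z ∷ zs ++ ys
  dropWhile-++-∷ (x ∷ xs) ys eq with P? x
  ... | yes _ = dropWhile-++-∷ xs ys eq
  ... | no  _ = cong (_++ ys) eq

module PotentialGames (F : OrderedField) (G : MPG F) where
  open OrderedField F
  open IsTotalOrder isTotalOrder using (antisym) renaming (refl to ≤-refl; trans to ≤-trans)
  open OrderedFieldProperties F
  open CommutativeRing commutativeRing using (+-assoc; +-identityʳ)
  open MPG G

  IsPotential : Strategy P1 → (Node → Carrier) → Set
  IsPotential σ φ = ∀ {v₀ u} (h : Hist v₀ u) (mv : Move u) → ((o : owner u ≡ P1) → mv ≡ σ h o) →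
                    φ (proj₁ mv) ≤ φ u + proj₁ (proj₂ mv)

  notFrom? : (c : Node) → Decidable (λ (move : Node × Carrier) → ¬ proj₁ move ≡ c)
  notFrom? c move = ¬? (proj₁ move ≟ c)

  suffixFrom : Node → List (Node × Carrier) → List (Node × Carrier)
  suffixFrom c = dropWhile (notFrom? c)

  weightOf : List (Node × Carrier) → Carrier
  weightOf steps = sumᶠ (map proj₂ steps)

  weightOf-snoc : ∀ xs u w → weightOf (xs ++ (u , w) ∷ []) ≡ weightOf xs + w
  weightOf-snoc xs u w = begin
    sumᶠ (map proj₂ (xs ++ (u , w) ∷ []))  ≡⟨ cong sumᶠ (map-++ proj₂ xs ((u , w) ∷ [])) ⟩
    sumᶠ (map proj₂ xs ++ w ∷ [])          ≡⟨ sumᶠ-++ (map proj₂ xs) (w ∷ []) ⟩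
    weightOf xs + (w + 0#)                 ≡⟨ cong (weightOf xs +_) (+-identityʳ w) ⟩
    weightOf xs + w                        ∎
    where open ≡-Reasoning

  module _ {σ : Strategy P1} {φ : Node → Carrier} (potential : IsPotential σ φ) where

    suffix-weight-bound : ∀ {v₀ u} (h : Hist v₀ u) → Follows σ h → ∀ c →
                          suffixFrom c (steps h) ≡ [] ⊎ φ u ≤ φ c + weightOf (suffixFrom c (steps h))
    suffix-weight-bound start start c = inj₁ refl
    suffix-weight-bound (_▷_ {u} h mv@(v , w , _)) (step f _ allowed) c
      with suffixFrom c (steps h) in eq | suffix-weight-bound h f c
    ... | [] | _ rewrite dropWhile-++-[] (notFrom? c) (steps h) ((u , w) ∷ []) eq with u ≟ c
    ...   | yes refl = inj₂ (subst (φ v ≤_) (cong (φ u +_) (sym (+-identityʳ w))) (potential h mv allowed))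
    ...   | no  _    = inj₁ refl
    suffix-weight-bound (_▷_ {u} h mv@(v , w , _)) (step f _ allowed) c | z ∷ zs | inj₂ bound
      rewrite dropWhile-++-∷ (notFrom? c) (steps h) ((u , w) ∷ []) eq
            | weightOf-snoc (z ∷ zs) u w
      = inj₂ (≤-trans (potential h mv allowed) (subst (φ u + w ≤_) (+-assoc _ _ _) (+-mono-≤ w bound)))

    cycle-weight-nonneg : ∀ {v₀ u} (h : Hist v₀ u) → Follows σ h → 0# ≤ sumᶠ (cycleWeights h)
    cycle-weight-nonneg {u = u} h f with suffixFrom u (steps h) | suffix-weight-bound h f u
    ... | []     | _          = ≤-refl
    ... | z ∷ zs | inj₂ bound = x≤x+y⇒0≤y (φ u) bound

    -- The play need not have ended: the cycle bound holds for every history following σ.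
    potential⇒winningStart : ∀ v₀ → WinningStart P1 v₀
    potential⇒winningStart v₀ = σ , λ h f _ (payoff≤0 , payoff≢0) →
      payoff≢0 (antisym payoff≤0 (mean-nonneg (cycleWeights h) (cycle-weight-nonneg h f)))

module ConsistentSchedule (F : OrderedField) {n m : ℕ} (H : HyTN F n m) (cov : EveryNodeIsTail F H)
                          (consistent : Consistent F H) where
  open OrderedField F
  open IsTotalOrder isTotalOrder using () renaming (refl to ≤-refl)
  open OrderedFieldProperties F using (-≤⇒≤+; commutativeRing)
  open CommutativeRing commutativeRing using (+-identityʳ)
  open HyTN H
  open MPG (associatedGame F H cov)
  open PotentialGames F (associatedGame F H cov)

  s : Fin n → Carrier
  s = proj₁ consistent

  chosenHead : Fin m → Fin n
  chosenHead A = proj₁ (proj₂ consistent A)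

  followSchedule : Strategy P1
  followSchedule {u = inj₁ _} _ ()
  followSchedule {u = inj₂ A} _ refl =
    inj₁ (chosenHead A) , weight A (chosenHead A) , proj₁ (proj₂ (proj₂ consistent A)) , refl

  extendedSchedule : Fin n ⊎ Fin m → Carrier
  extendedSchedule (inj₁ v) = s v
  extendedSchedule (inj₂ A) = s (tail A)

  extendedSchedule-isPotential : IsPotential followSchedule extendedSchedule
  extendedSchedule-isPotential {u = inj₁ _} _ (inj₂ A , _ , refl , refl) _ =
    subst (s (tail A) ≤_) (sym (+-identityʳ (s (tail A)))) ≤-refl
  extendedSchedule-isPotential {u = inj₂ A} _ _ allowed with allowed refl
  ... | refl = -≤⇒≤+ (weight A (chosenHead A)) (proj₂ (proj₂ (proj₂ consistent A)))

lemma4 : (F : OrderedField) → ∀ {n m} (H : HyTN F n m) (cov : EveryNodeIsTail F H) →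
    Consistent F H →
    ∀ x → MPG.WinningStart (associatedGame F H cov) P1 x
lemma4 F H cov consistent =
  PotentialGames.potential⇒winningStart F (associatedGame F H cov) extendedSchedule-isPotential
  where open ConsistentSchedule F H cov consistent
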